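{- Let $(P,\Pi\cup\theta\Pi)$ be a permutation-bipartition pair such that $\{b\}$ is a block of $\Pi$ (so $\{\theta b\}$ is a block of $\theta\Pi$), and let $(P_{b,\theta b},\Pi_b\cup\theta\Pi_b)=(P,\Pi\cup\theta\Pi)|^{b\rightarrow b}_{\theta b\rightarrow\theta b}$. Then the map $$f:S(\Pi\cup\theta\Pi,\ b\rightarrow b,\ \theta b\rightarrow\theta b)\to S(\Pi_b\cup\theta\Pi_b),\qquad f(Q)=(Q/b)/\theta b=:Q_{b,\theta b}$$ is a bijection such that for every $Q$ in its domain $$\|PQ\|=\|P_{b,\theta b}Q_{b,\theta b}\|+\delta_{b,bP}+\delta_{\theta bP_b,\theta b},$$ where $\delta$ is the Kronecker delta.
   Context: Let $S$ and $S_\theta$ be disjoint finite sets of equal size and $\theta$ a fixed-point-free involution of $S\cup S_\theta$ mapping $S$ onto $S_\theta$. Permutations act on the right ($xP$ is the image of $x$, $x(PQ)=(xP)Q$). $\|P\|$ is the number of cycles of $P$, fixed points counted. A permutation-bipartition pair $(P,\Pi\cup\theta\Pi)$ consists of a permutation $P$ of $S\cup S_\theta$ such that whenever $(x_1,x_2,\ldots,x_m)$ is a cycle of $P$, $(\theta x_1,\theta x_m,\ldots,\theta x_2)$ is also a cycle, together with a partition $\Pi=\{\Pi_1,\ldots,\Pi_k\}$ of $S$ and $\theta\Pi=\{\theta\Pi_i\}$. An embedding (bi-rotation) is a permutation $Q$ whose cycles are, for each block $\Pi_i=\{a_1,\ldots,a_m\}$, a cycle $(a_{j_1},\ldots,a_{j_m})$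 and the cycle $(\theta a_{j_m},\ldots,\theta a_{j_2},\theta a_{j_1})$ for some ordering $j_1,\ldots,j_m$ of $1,\ldots,m$; $S(\Pi\cup\theta\Pi)$ is the set of embeddings and $S(\Pi\cup\theta\Pi,b\rightarrow b,\theta b\rightarrow\theta b)=\{Q\in S(\Pi\cup\theta\Pi): bQ=b,\ \theta bQ=\theta b\}$. $P/x$ denotes deletion of $x$ from the cycle decomposition of $P$ (likewise $Q/x$). For a singleton block $\{b\}$, the reduction is $P_b=P/b$, $P_{b,\theta b}=P_b/\theta b$, $\Pi_b=\Pi$ with the block $\{b\}$ removed, $\theta\Pi_b=\theta\Pi$ with $\{\theta b\}$ removed, and $(P,\Pi\cup\theta\Pi)|^{b\rightarrow b}_{\theta b\rightarrow\theta b}=(P_{b,\theta b},\Pi_b\cup\theta\Pi_b)$. -}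

module Defs where

open import Data.Nat using (ℕ; zero; suc; _+_; _*_; _≤_; _≤?_)
open import Data.Nat.Properties using () renaming (_≟_ to _≟ℕ_)
open import Data.Bool using (Bool; true; false; not; if_then_else_)
open import Data.Bool.Properties using () renaming (_≟_ to _≟B_)
open import Data.Fin using (Fin; toℕ; punchIn; punchOut)
open import Data.Fin.Properties using (all?) renaming (_≟_ to _≟F_)
open import Data.Product using (Σ; ∃; _×_; _,_; proj₁; proj₂)
open import Data.Product.Properties using (≡-dec)
open import Data.List using (List; []; _∷_; concatMap; filter; length; allFin)
open import Function.Definitions using (Bijective)
open import Relation.Binary.PropositionalEquality using (_≡_)
open import Relation.Binary.Definitions using (DecidableEquality)
open import Relation.Nullary using (Dec; yes; no; ¬_; does)

-- Ground set S ∪ S_θ with |S| = n, modelled as Fin n × Bool: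
-- S = {(i , false)}, S_θ = {(i , true)}, θ (i , s) = (i , not s).
X : ℕ → Set
X n = Fin n × Bool

θ : ∀ {n} → X n → X n
θ (i , s) = (i , not s)

inS : ∀ {n} → Fin n → X n
inS i = (i , false)

_≟X_ : ∀ {n} → DecidableEquality (X n)
_≟X_ = ≡-dec _≟F_ _≟B_

-- Maps on the ground set; permutations act on the right: x P = P x,
-- so the product PQ (x(PQ) = (xP)Q) is the function  Q ∘ P.
Map : ℕ → Set
Map n = X n → X n

_·_ : ∀ {n} → Map n → Map n → Map n
(P · Q) x = Q (P x)

IsPerm : ∀ {n} → Map n → Set
IsPerm P = Bijective _≡_ _≡_ P

iter : ∀ {n} → ℕ → Map n → Map n
iter zero    P x = x
iter (suc k) P x = P (iter k P x)

-- Number of cycles ‖P‖ (fixed points counted): the number of elements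
-- that are the least element (w.r.t. the rank below) of their cycle.
-- For a permutation of the 2n-element set, the cycle of x is
-- {x P^k | k < 2n}.
rank : ∀ {n} → X n → ℕ
rank (i , false) = 2 * toℕ i
rank (i , true)  = suc (2 * toℕ i)

elems : ∀ n → List (X n)
elems n = concatMap (λ i → (i , false) ∷ (i , true) ∷ []) (allFin n)

isCycleMin? : ∀ {n} (P : Map n) (x : X n) →
              Dec (∀ (k : Fin (n + n)) → rank x ≤ rank (iter (toℕ k) P x))
isCycleMin? {n} P x = all? (λ k → rank x ≤? rank (iter (toℕ k) P x))

‖_‖ : ∀ {n} → Map n → ℕ
‖_‖ {n} P = length (filter (isCycleMin? P) (elems n))

-- A partition Π of S = Fin n, given by a block label for each element:
-- the blocks are the nonempty fibres of the labelling.
Partition : ℕ → Set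
Partition n = Fin n → ℕ

-- Permutation-bipartition pair: P is a permutation of S ∪ S_θ such that
-- for each cycle (x₁,…,x_m) of P, (θx₁, θx_m, …, θx₂) is a cycle,
-- i.e. (θ(xP))P = θx for every x.
IsPBPair : ∀ {n} → Map n → Partition n → Set
IsPBPair P Π = IsPerm P × (∀ x → P (θ (P x)) ≡ θ x)

-- Embeddings S(Π ∪ θΠ): Q is a permutation; on S, each block of Π is
-- exactly one cycle of Q (Q maps S into S preserving blocks, and any two
-- elements of a block lie on a common cycle); and for a ∈ S the cycle
-- (a_{j1},…,a_{jm}) is accompanied by (θa_{jm},…,θa_{j1}), i.e.
-- (θ(aQ))Q = θa.
IsEmbedding : ∀ {n} → Partition n → Map n → Set
IsEmbedding {n} Π Q =
  IsPerm Q
  × (∀ i → Σ (Fin n) λ j → Q (inS i) ≡ inS j × Π j ≡ Π i)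
  × (∀ i j → Π i ≡ Π j → Σ ℕ λ k → iter k Q (inS i) ≡ inS j)
  × (∀ i → Q (θ (Q (inS i))) ≡ θ (inS i))

-- Deletion P/x from the cycle decomposition: y ↦ yP, unless yP = x, in
-- which case y ↦ xP (meaningful for y ≠ x; the value at x is irrelevant).
del : ∀ {n} → Map n → X n → Map n
del P x y = if does (P y ≟X x) then P x else P y

-- Re-indexing of S∖{b} ∪ S_θ∖{θb} (b = (i₀ , false)) as X n.
raise : ∀ {n} → Fin (suc n) → X n → X (suc n)
raise i₀ (j , s) = (punchIn i₀ j , s)

-- inverse of punchIn i₀ away from i₀ (default value d at i₀, never used)
lowerFin : ∀ {n} → Fin n → Fin (suc n) → Fin (suc n) → Fin n
lowerFin d i₀ j with i₀ ≟F j
... | yes _  = d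
... | no i≢j = punchOut i≢j

-- P_{b,θb} = (P/b)/θb on S∖{b} ∪ S_θ∖{θb}, with b = (i₀ , false).
reduce : ∀ {n} → Fin (suc n) → Map (suc n) → Map n
reduce i₀ P y =
  let z = del (del P (inS i₀)) (θ (inS i₀)) (raise i₀ y)
  in (lowerFin (proj₁ y) i₀ (proj₁ z) , proj₂ z)

-- Π_b : Π with the block {b} removed (re-indexed to Fin n).
reducePartition : ∀ {n} → Fin (suc n) → Partition (suc n) → Partition n
reducePartition i₀ Π j = Π (punchIn i₀ j)

δ : ∀ {n} → X n → X n → ℕ
δ x y = if does (x ≟X y) then 1 else 0

{-# OPTIONS --safe #-}
-- Deleting a
-- point b from a permutation shortens the cycle through b and leaves the other
-- cycles alone, so exactly one cycle is lost if b was a fixed point and none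
-- otherwise. When Q fixes b and θb, deleting b and then θb from PQ gives
-- ((P/b)/θb)·Q, whose restriction to the remaining points is P_{b,θb}Q_{b,θb};
-- this is the cycle-count formula with its two Kronecker deltas.
-- Such a Q is determined by Q_{b,θb}, and conversely every embedding of Π_b
-- extends to one of Π by fixing b and θb; the extension is an embedding
-- because {b} is a block of its own.
module Submission where

open import Defs
open import Data.Bool as Bool using (true; false; if_then_else_)
open import Data.Bool.Properties using () renaming (≤-antisym to ≤ᵇ-antisym)
open import Data.Empty using (⊥-elim)
open import Data.Fin as Fin using (Fin; toℕ; punchIn; punchOut; join; splitAt; fromℕ<)
open import Data.Fin.Properties
  using ( toℕ-injective; toℕ-fromℕ<; toℕ<n; splitAt-join; pigeonhole; any?
        ; punchIn-injective; punchIn-mono-≤; punchIn-cancel-≤; punchInᵢ≢i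
        ; punchIn-punchOut; punchOut-punchIn; punchOut-cong′ )
  renaming (_≟_ to _≟F_)
open import Data.List using (List; []; _∷_; _++_; filter; length; concatMap; tabulate)
open import Data.List.Properties using (filter-++; length-++)
open import Data.Nat using (ℕ; zero; suc; _+_; _*_; _∸_; _≤_; _<_; _≤?_; z≤n; s≤s; s≤s⁻¹)
open import Data.Nat.Properties
  using ( +-comm; +-suc; +-identityʳ; *-suc; *-monoʳ-≤; m∸n+n≡m; m≤n+m; n<1+n; n≤1+n
        ; ≤-refl; ≤-reflexive; ≤-trans; ≤-antisym; <-≤-trans; ≤-<-trans; <⇒≤; <⇒≱; ≰⇒>; ≤∧≢⇒<
        ; <-asym; <-irrefl; <-cmp; m≤n⇒m<n∨m≡n; m≤n⇒m≤1+n; m≤n⇒∃[o]m+o≡n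
        ; +-commutativeSemigroup; +-0-commutativeMonoid )
open import Data.Product using (Σ; ∃; _×_; _,_; proj₁; proj₂)
open import Data.Sum using (_⊎_; inj₁; inj₂)
open import Data.Unit using (⊤; tt)
open import Function using (case_of_)
open import Relation.Binary.Definitions using (tri<; tri≈; tri>)
open import Relation.Binary.PropositionalEquality
open import Relation.Nullary using (Dec; yes; no; ¬_; does)
open import Relation.Nullary.Decidable using (_×-dec_; ¬?)
open import Relation.Unary using (Decidable)

open import Algebra.Properties.CommutativeSemigroup +-commutativeSemigroup using (interchange; xy∙z≈xz∙y)
open import Algebra.Properties.CommutativeMonoid.Sum +-0-commutativeMonoid
  using (sum; sum-remove; ∑-distrib-+; sum-cong-≗; sum-replicate-zero)

-- Defined through does, so that δ x y is 𝟙 (x ≟X y) by computation.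
𝟙 : {A : Set} → Dec A → ℕ
𝟙 p = if does p then 1 else 0

𝟙-yes : {A : Set} (p : Dec A) → A → 𝟙 p ≡ 1
𝟙-yes (yes _) _ = refl
𝟙-yes (no ¬a) a = ⊥-elim (¬a a)

𝟙-no : {A : Set} (p : Dec A) → ¬ A → 𝟙 p ≡ 0
𝟙-no (yes a) ¬a = ⊥-elim (¬a a)
𝟙-no (no _) _ = refl

𝟙-cong : {A B : Set} (p : Dec A) (q : Dec B) → (A → B) → (B → A) → 𝟙 p ≡ 𝟙 q
𝟙-cong (yes a) q to _ = sym (𝟙-yes q (to a))
𝟙-cong (no ¬a) q _ from = sym (𝟙-no q (λ b → ¬a (from b)))

𝟙-split : {A B : Set} (p : Dec A) (q : Dec B) → 𝟙 p ≡ 𝟙 (p ×-dec q) + 𝟙 (p ×-dec ¬? q)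
𝟙-split (yes _) (yes _) = refl
𝟙-split (yes _) (no _) = refl
𝟙-split (no _) _ = refl

𝟙-¬? : {A : Set} (p : Dec A) → 𝟙 (¬? p) + 𝟙 p ≡ 1
𝟙-¬? (yes _) = refl
𝟙-¬? (no _) = refl

ΣX : ∀ {m} → (X m → ℕ) → ℕ
ΣX f = sum (λ i → f (i , false) + f (i , true))

ΣX-cong : ∀ {m} {f g : X m → ℕ} → (∀ x → f x ≡ g x) → ΣX f ≡ ΣX g
ΣX-cong {m} f≗g = sum-cong-≗ {m} (λ i → cong₂ _+_ (f≗g _) (f≗g _))

ΣX-+ : ∀ {m} (f g : X m → ℕ) → ΣX (λ x → f x + g x) ≡ ΣX f + ΣX g
ΣX-+ f g = trans (sum-cong-≗ regroup)
  (∑-distrib-+ (λ i → f (i , false) + f (i , true)) (λ i → g (i , false) + g (i , true)))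
  where
  regroup : ∀ i → (f (i , false) + g (i , false)) + (f (i , true) + g (i , true))
                ≡ (f (i , false) + f (i , true)) + (g (i , false) + g (i , true))
  regroup i = interchange (f (i , false)) (g (i , false)) (f (i , true)) (g (i , true))

ΣX-split : ∀ {m} {A B : X m → Set} (p : ∀ x → Dec (A x)) (q : ∀ x → Dec (B x)) →
           ΣX (λ x → 𝟙 (p x)) ≡ ΣX (λ x → 𝟙 (p x ×-dec q x)) + ΣX (λ x → 𝟙 (p x ×-dec ¬? (q x)))
ΣX-split p q = trans (ΣX-cong (λ x → 𝟙-split (p x) (q x)))
  (ΣX-+ (λ x → 𝟙 (p x ×-dec q x)) (λ x → 𝟙 (p x ×-dec ¬? (q x))))

ΣX-zero : ∀ {m} (f : X m → ℕ) → (∀ x → f x ≡ 0) → ΣX f ≡ 0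
ΣX-zero {m} f f≗0 = trans (ΣX-cong f≗0) (sum-replicate-zero m)

ΣX-remove : ∀ {n} (i : Fin (suc n)) (f : X (suc n) → ℕ) →
            ΣX f ≡ (f (inS i) + f (θ (inS i))) + ΣX (λ y → f (raise i y))
ΣX-remove i f = sum-remove {i = i} (λ j → f (j , false) + f (j , true))

raise≢pivot : ∀ {n} (i : Fin (suc n)) y s → raise i y ≢ (i , s)
raise≢pivot i (j , _) s e = punchInᵢ≢i i j (cong proj₁ e)

ΣX-single : ∀ {m} (f : X m → ℕ) (c : X m) → (∀ x → x ≢ c → f x ≡ 0) → ΣX f ≡ f c
ΣX-single {suc n} f (i , s) f≗0 = begin
  ΣX f                                                     ≡⟨ ΣX-remove i f ⟩
  (f (i , false) + f (i , true)) + ΣX (λ y → f (raise i y))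
    ≡⟨ cong (_ +_) (ΣX-zero _ (λ y → f≗0 _ (raise≢pivot i y s))) ⟩
  (f (i , false) + f (i , true)) + 0                        ≡⟨ +-identityʳ _ ⟩
  f (i , false) + f (i , true)                              ≡⟨ column s f≗0 ⟩
  f (i , s)                                                 ∎
  where
  open ≡-Reasoning
  column : ∀ t → (∀ x → x ≢ (i , t) → f x ≡ 0) → f (i , false) + f (i , true) ≡ f (i , t)
  column false g≗0 = trans (cong (f (i , false) +_) (g≗0 (i , true) λ ())) (+-identityʳ _)
  column true  g≗0 = cong (_+ f (i , true)) (g≗0 (i , false) λ ())

length-filter-∷ : ∀ {A : Set} {P : A → Set} (p? : Decidable P) x xs →
                  length (filter p? (x ∷ xs)) ≡ 𝟙 (p? x) + length (filter p? xs)
length-filter-∷ p? x xs with p? x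
... | yes _ = refl
... | no _  = refl

length-filter-concatMap : ∀ {A B : Set} {P : A → Set} (p? : Decidable P) (g : B → List A) {k} (f : Fin k → B) →
  length (filter p? (concatMap g (tabulate f))) ≡ sum (λ i → length (filter p? (g (f i))))
length-filter-concatMap p? g {zero} f = refl
length-filter-concatMap p? g {suc k} f = begin
  length (filter p? (g (f Fin.zero) ++ rest))                    ≡⟨ cong length (filter-++ p? (g (f Fin.zero)) rest) ⟩
  length (filter p? (g (f Fin.zero)) ++ filter p? rest)          ≡⟨ length-++ (filter p? (g (f Fin.zero))) ⟩
  length (filter p? (g (f Fin.zero))) + length (filter p? rest)
    ≡⟨ cong (_ +_) (length-filter-concatMap p? g (λ i → f (Fin.suc i))) ⟩
  sum (λ i → length (filter p? (g (f i))))                       ∎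
  where
  open ≡-Reasoning
  rest = concatMap g (tabulate (λ i → f (Fin.suc i)))

length-filter-elems : ∀ {m} {P : X m → Set} (p? : Decidable P) → length (filter p? (elems m)) ≡ ΣX (λ x → 𝟙 (p? x))
length-filter-elems {m} p? = trans (length-filter-concatMap p? _ {m} (λ i → i)) (sum-cong-≗ {m} pair)
  where
  pair : ∀ i → length (filter p? ((i , false) ∷ (i , true) ∷ [])) ≡ 𝟙 (p? (i , false)) + 𝟙 (p? (i , true))
  pair i = trans (length-filter-∷ p? (i , false) _)
                 (cong (𝟙 (p? (i , false)) +_) (trans (length-filter-∷ p? (i , true) []) (+-identityʳ _)))

‖‖-as-ΣX : ∀ {m} (F : Map m) → ‖ F ‖ ≡ ΣX (λ x → 𝟙 (isCycleMin? F x))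
‖‖-as-ΣX F = length-filter-elems (isCycleMin? F)

infix 4 _⊑_
_⊑_ : ∀ {m} → X m → X m → Set
(i , s) ⊑ (j , t) = toℕ i < toℕ j ⊎ (i ≡ j × s Bool.≤ t)

rank-lower : ∀ {m} (u : X m) → 2 * toℕ (proj₁ u) ≤ rank u
rank-lower (i , false) = ≤-refl
rank-lower (i , true)  = n≤1+n _

rank-upper : ∀ {m} (u : X m) → rank u ≤ suc (2 * toℕ (proj₁ u))
rank-upper (i , false) = n≤1+n _
rank-upper (i , true)  = ≤-refl

column<⇒rank< : ∀ {m} (u v : X m) → toℕ (proj₁ u) < toℕ (proj₁ v) → rank u < rank v
column<⇒rank< u v u<v = ≤-<-trans (rank-upper u) (<-≤-trans double< (rank-lower v))
  where
  double< : suc (2 * toℕ (proj₁ u)) < 2 * toℕ (proj₁ v)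
  double< = subst (_≤ 2 * toℕ (proj₁ v)) (*-suc 2 (toℕ (proj₁ u))) (*-monoʳ-≤ 2 u<v)

⊑⇒rank-≤ : ∀ {m} (u v : X m) → u ⊑ v → rank u ≤ rank v
⊑⇒rank-≤ u v (inj₁ u<v) = <⇒≤ (column<⇒rank< u v u<v)
⊑⇒rank-≤ (i , false) (.i , t) (inj₂ (refl , _)) = rank-lower (i , t)
⊑⇒rank-≤ (i , true) (.i , .true) (inj₂ (refl , Bool.b≤b)) = ≤-refl

rank-≤⇒⊑ : ∀ {m} (u v : X m) → rank u ≤ rank v → u ⊑ v
rank-≤⇒⊑ u v u≤v with <-cmp (toℕ (proj₁ u)) (toℕ (proj₁ v))
... | tri< u<v _ _ = inj₁ u<v
... | tri> _ _ v<u = ⊥-elim (<⇒≱ (column<⇒rank< v u v<u) u≤v)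
... | tri≈ _ u≈v _ = same-column u v (toℕ-injective u≈v) u≤v
  where
  same-column : ∀ {m} (u v : X m) → proj₁ u ≡ proj₁ v → rank u ≤ rank v → u ⊑ v
  same-column (i , false) (.i , false) refl _ = inj₂ (refl , Bool.b≤b)
  same-column (i , false) (.i , true)  refl _ = inj₂ (refl , Bool.f≤t)
  same-column (i , true)  (.i , true)  refl _ = inj₂ (refl , Bool.b≤b)
  same-column (i , true)  (.i , false) refl 1+2i≤2i = ⊥-elim (<-irrefl refl 1+2i≤2i)

⊑-antisym : ∀ {m} {u v : X m} → u ⊑ v → v ⊑ u → u ≡ v
⊑-antisym (inj₁ u<v) (inj₁ v<u) = ⊥-elim (<-asym u<v v<u)
⊑-antisym (inj₁ u<v) (inj₂ (refl , _)) = ⊥-elim (<-irrefl refl u<v)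
⊑-antisym (inj₂ (refl , _)) (inj₁ v<u) = ⊥-elim (<-irrefl refl v<u)
⊑-antisym (inj₂ (refl , s≤t)) (inj₂ (_ , t≤s)) = cong (_ ,_) (≤ᵇ-antisym s≤t t≤s)

rank-injective : ∀ {m} (u v : X m) → rank u ≡ rank v → u ≡ v
rank-injective u v e = ⊑-antisym (rank-≤⇒⊑ u v (≤-reflexive e)) (rank-≤⇒⊑ v u (≤-reflexive (sym e)))

punchIn-mono-< : ∀ {n} (k : Fin (suc n)) (i j : Fin n) → toℕ i < toℕ j → toℕ (punchIn k i) < toℕ (punchIn k j)
punchIn-mono-< k i j i<j = ≤∧≢⇒< (punchIn-mono-≤ k i j (<⇒≤ i<j))
  (λ e → <-irrefl (cong toℕ (punchIn-injective k i j (toℕ-injective e))) i<j)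

punchIn-cancel-< : ∀ {n} (k : Fin (suc n)) (i j : Fin n) → toℕ (punchIn k i) < toℕ (punchIn k j) → toℕ i < toℕ j
punchIn-cancel-< k i j ki<kj = ≤∧≢⇒< (punchIn-cancel-≤ k i j (<⇒≤ ki<kj))
  (λ e → <-irrefl (cong (λ l → toℕ (punchIn k l)) (toℕ-injective e)) ki<kj)

raise-⊑ : ∀ {n} (k : Fin (suc n)) (u v : X n) → u ⊑ v → raise k u ⊑ raise k v
raise-⊑ k (i , _) (j , _) (inj₁ i<j) = inj₁ (punchIn-mono-< k i j i<j)
raise-⊑ k (i , _) (.i , _) (inj₂ (refl , s≤t)) = inj₂ (refl , s≤t)

raise-⊑⁻ : ∀ {n} (k : Fin (suc n)) (u v : X n) → raise k u ⊑ raise k v → u ⊑ v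
raise-⊑⁻ k (i , _) (j , _) (inj₁ ki<kj) = inj₁ (punchIn-cancel-< k i j ki<kj)
raise-⊑⁻ k (i , _) (j , _) (inj₂ (ki≡kj , s≤t)) with punchIn-injective k i j ki≡kj
... | refl = inj₂ (refl , s≤t)

rank-raise-≤ : ∀ {n} (k : Fin (suc n)) (u v : X n) → rank u ≤ rank v → rank (raise k u) ≤ rank (raise k v)
rank-raise-≤ k u v u≤v = ⊑⇒rank-≤ _ _ (raise-⊑ k u v (rank-≤⇒⊑ u v u≤v))

rank-raise-≤⁻ : ∀ {n} (k : Fin (suc n)) (u v : X n) → rank (raise k u) ≤ rank (raise k v) → rank u ≤ rank v
rank-raise-≤⁻ k u v ku≤kv = ⊑⇒rank-≤ u v (raise-⊑⁻ k u v (rank-≤⇒⊑ _ _ ku≤kv))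

iter-+ : ∀ {m} (F : Map m) a b x → iter (a + b) F x ≡ iter a F (iter b F x)
iter-+ F zero    b x = refl
iter-+ F (suc a) b x = cong F (iter-+ F a b x)

iter-fixed : ∀ {m} (F : Map m) {x} → F x ≡ x → ∀ k → iter k F x ≡ x
iter-fixed F Fx≡x zero    = refl
iter-fixed F Fx≡x (suc k) = trans (cong F (iter-fixed F Fx≡x k)) Fx≡x

iter-cong : ∀ {m} {F G : Map m} → F ≗ G → ∀ k x → iter k F x ≡ iter k G x
iter-cong F≗G zero    x = refl
iter-cong {G = G} F≗G (suc k) x = trans (F≗G _) (cong G (iter-cong F≗G k x))

Reach : ∀ {m} → Map m → X m → X m → Set
Reach F x y = ∃ λ k → iter k F x ≡ y

Reach-trans : ∀ {m} {F : Map m} {x y z} → Reach F x y → Reach F y z → Reach F x z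
Reach-trans {F = F} {x} (a , refl) (b , refl) = b + a , iter-+ F b a x

ReachWithin : ∀ {m} → Map m → X m → X m → Set
ReachWithin {m} F x y = ∃ λ (k : Fin (m + m)) → iter (toℕ k) F x ≡ y

reachWithin? : ∀ {m} (F : Map m) x y → Dec (ReachWithin F x y)
reachWithin? F x y = any? (λ k → iter (toℕ k) F x ≟X y)

CycleMinWithin : ∀ {m} → Map m → X m → Set
CycleMinWithin {m} F x = ∀ (k : Fin (m + m)) → rank x ≤ rank (iter (toℕ k) F x)

IsCycleMin : ∀ {m} → Map m → X m → Set
IsCycleMin F x = ∀ k → rank x ≤ rank (iter k F x)

iter-mod-period : ∀ {m} (F : Map m) {x} p → iter (suc p) F x ≡ x →
                  ∀ k → ∃ λ k′ → k′ ≤ p × iter k F x ≡ iter k′ F x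
iter-mod-period F p periodic zero = 0 , z≤n , refl
iter-mod-period F p periodic (suc k) with iter-mod-period F p periodic k
... | k′ , k′≤p , e with m≤n⇒m<n∨m≡n k′≤p
...   | inj₁ k′<p = suc k′ , k′<p , cong F e
...   | inj₂ refl = 0 , z≤n , trans (cong F e) periodic

Reach-sym-periodic : ∀ {m} (F : Map m) {x y} p → iter (suc p) F x ≡ x → Reach F x y → Reach F y x
Reach-sym-periodic F {x} p periodic (k , refl) with iter-mod-period F p periodic k
... | k′ , k′≤p , e = suc p ∸ k′ , (begin
  iter (suc p ∸ k′) F (iter k F x)   ≡⟨ cong (iter (suc p ∸ k′) F) e ⟩
  iter (suc p ∸ k′) F (iter k′ F x)  ≡⟨ iter-+ F (suc p ∸ k′) k′ x ⟨
  iter (suc p ∸ k′ + k′) F x         ≡⟨ cong (λ l → iter l F x) (m∸n+n≡m (m≤n⇒m≤1+n k′≤p)) ⟩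
  iter (suc p) F x                   ≡⟨ periodic ⟩
  x                                  ∎)
  where open ≡-Reasoning

toSum : ∀ {m} → X m → Fin m ⊎ Fin m
toSum (i , false) = inj₁ i
toSum (i , true)  = inj₂ i

toSum-injective : ∀ {m} {u v : X m} → toSum u ≡ toSum v → u ≡ v
toSum-injective {u = _ , false} {_ , false} refl = refl
toSum-injective {u = _ , true}  {_ , true}  refl = refl
toSum-injective {u = _ , false} {_ , true}  ()
toSum-injective {u = _ , true}  {_ , false} ()

encode : ∀ {m} → X m → Fin (m + m)
encode {m} u = join m m (toSum u)

encode-injective : ∀ {m} {u v : X m} → encode u ≡ encode v → u ≡ v
encode-injective {m} {u} {v} e =
  toSum-injective (trans (sym (splitAt-join m m (toSum u))) (trans (cong (splitAt m) e) (splitAt-join m m (toSum v))))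

minimiser : (f : ℕ → ℕ) (K : ℕ) → ∃ λ k → k ≤ K × (∀ j → j ≤ K → f k ≤ f j)
minimiser f zero = 0 , z≤n , λ { .0 z≤n → ≤-refl }
minimiser f (suc K) with minimiser f K
... | k , k≤K , k-min with f k ≤? f (suc K)
...   | yes fk≤ = k , m≤n⇒m≤1+n k≤K , least
  where
  least : ∀ j → j ≤ suc K → f k ≤ f j
  least j j≤1+K with m≤n⇒m<n∨m≡n j≤1+K
  ... | inj₁ j<1+K = k-min j (s≤s⁻¹ j<1+K)
  ... | inj₂ refl  = fk≤
...   | no fk≰ = suc K , ≤-refl , least
  where
  least : ∀ j → j ≤ suc K → f (suc K) ≤ f j
  least j j≤1+K with m≤n⇒m<n∨m≡n j≤1+K
  ... | inj₁ j<1+K = ≤-trans (<⇒≤ (≰⇒> fk≰)) (k-min j (s≤s⁻¹ j<1+K))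
  ... | inj₂ refl  = ≤-refl

-- An injective self-map of a subset D of the finite set X m permutes D, so every
-- point of D returns within m + m steps: on D the bounded searches of Defs are exact.
module Orbits {m} (F : Map m) (D : X m → Set) (D? : ∀ x → Dec (D x))
              (F-pres : ∀ {x} → D x → D (F x))
              (F-inj : ∀ {x y} → D x → D y → F x ≡ F y → x ≡ y) where

  cycleMin? : ∀ x → Dec (D x × CycleMinWithin F x)
  cycleMin? x = D? x ×-dec isCycleMin? F x

  cycleMins : ℕ
  cycleMins = ΣX (λ x → 𝟙 (cycleMin? x))

  iter-pres : ∀ {x} → D x → ∀ k → D (iter k F x)
  iter-pres Dx zero    = Dx
  iter-pres Dx (suc k) = F-pres (iter-pres Dx k)

  iter-cancel : ∀ {x} → D x → ∀ a d → iter (a + d) F x ≡ iter a F x → iter d F x ≡ x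
  iter-cancel Dx zero    d e = e
  iter-cancel Dx (suc a) d e = iter-cancel Dx a d (F-inj (iter-pres Dx (a + d)) (iter-pres Dx a) e)

  period : ∀ {x} → D x → ∃ λ p → suc p ≤ m + m × iter (suc p) F x ≡ x
  period {x} Dx with pigeonhole (n<1+n (m + m)) (λ k → encode (iter (toℕ k) F x))
  ... | i , j , i<j , same with m≤n⇒∃[o]m+o≡n i<j
  ...   | p , 1+i+p≡j = p , bound , iter-cancel Dx (toℕ i) (suc p) returns
    where
    bound : suc p ≤ m + m
    bound = ≤-trans (s≤s (m≤n+m p (toℕ i))) (subst (_≤ m + m) (sym 1+i+p≡j) (s≤s⁻¹ (toℕ<n j)))
    returns : iter (toℕ i + suc p) F x ≡ iter (toℕ i) F x
    returns = trans (cong (λ l → iter l F x) (trans (+-suc (toℕ i) p) 1+i+p≡j)) (sym (encode-injective same))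

  iter-within : ∀ {x} → D x → ∀ k → ∃ λ k′ → k′ < m + m × iter k F x ≡ iter k′ F x
  iter-within Dx k with period Dx
  ... | p , 1+p≤2m , periodic with iter-mod-period F p periodic k
  ...   | k′ , k′≤p , e = k′ , <-≤-trans (s≤s k′≤p) 1+p≤2m , e

  Reach-sym : ∀ {x y} → D x → Reach F x y → Reach F y x
  Reach-sym Dx = Reach-sym-periodic F (proj₁ (period Dx)) (proj₂ (proj₂ (period Dx)))

  reach⇒within : ∀ {x y} → D x → Reach F x y → ReachWithin F x y
  reach⇒within Dx (k , refl) with iter-within Dx k
  ... | k′ , k′<2m , e = fromℕ< k′<2m , trans (cong (λ l → iter l F _) (toℕ-fromℕ< k′<2m)) (sym e)

  within⇒cycleMin : ∀ {x} → D x → CycleMinWithin F x → IsCycleMin F x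
  within⇒cycleMin {x} Dx bounded k with iter-within Dx k
  ... | k′ , k′<2m , e = subst (λ z → rank x ≤ rank z) (sym e)
    (subst (λ l → rank x ≤ rank (iter l F x)) (toℕ-fromℕ< k′<2m) (bounded (fromℕ< k′<2m)))

  cycleMin-unique : ∀ {x y} → D x → IsCycleMin F x → IsCycleMin F y → Reach F x y → x ≡ y
  cycleMin-unique {x} Dx x-min y-min x→y@(k , refl) with Reach-sym Dx x→y
  ... | l , y→x = rank-injective x (iter k F x)
    (≤-antisym (x-min k) (subst (λ z → rank (iter k F x) ≤ rank z) y→x (y-min l)))

  one-cycleMin-per-orbit : ∀ {c} → D c →
    ΣX (λ x → 𝟙 (cycleMin? x ×-dec reachWithin? F x c)) ≡ 1
  one-cycleMin-per-orbit {c} Dc with minimiser (λ k → rank (iter k F c)) (m + m)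
  ... | k₀ , _ , k₀-least = trans (ΣX-single reaching x₀ others)
    (𝟙-yes (cycleMin? x₀ ×-dec reachWithin? F x₀ c)
      ((Dx₀ , λ k → x₀-min (toℕ k)) , reach⇒within Dx₀ (Reach-sym Dc (k₀ , refl))))
    where
    reaching : X m → ℕ
    reaching x = 𝟙 (cycleMin? x ×-dec reachWithin? F x c)
    x₀ = iter k₀ F c
    Dx₀ = iter-pres Dc k₀
    x₀-min : IsCycleMin F x₀
    x₀-min j with iter-within Dc (j + k₀)
    ... | j′ , j′<2m , e = subst (λ z → rank x₀ ≤ rank z) (trans (sym e) (iter-+ F j k₀ c)) (k₀-least j′ (<⇒≤ j′<2m))
    others : ∀ x → x ≢ x₀ → reaching x ≡ 0
    others x x≢x₀ = 𝟙-no (cycleMin? x ×-dec reachWithin? F x c) λ ((Dx , x-min) , (k , x→c)) →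
      x≢x₀ (cycleMin-unique Dx (within⇒cycleMin Dx x-min) x₀-min (Reach-trans (toℕ k , x→c) (k₀ , refl)))

del-cases : ∀ {m} (F : Map m) b y → (F y ≡ b × del F b y ≡ F b) ⊎ (F y ≢ b × del F b y ≡ F y)
del-cases F b y with F y ≟X b
... | yes hit  = inj₁ (hit , refl)
... | no  miss = inj₂ (miss , refl)

del-miss : ∀ {m} (F : Map m) {b y} → F y ≢ b → del F b y ≡ F y
del-miss F {b} {y} miss with del-cases F b y
... | inj₁ (hit , _) = ⊥-elim (miss hit)
... | inj₂ (_ , d)   = d

Reach-del⁻ : ∀ {m} (F : Map m) {b x y} → Reach (del F b) x y → Reach F x y
Reach-del⁻ F (zero , refl) = 0 , refl
Reach-del⁻ F {b} {x} (suc k , refl) with Reach-del⁻ F (k , refl) | del-cases F b (iter k (del F b) x)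
... | k′ , e | inj₁ (hit , d) = suc (suc k′) , trans (cong (λ z → F (F z)) e) (trans (cong F hit) (sym d))
... | k′ , e | inj₂ (_ , d)   = suc k′ , trans (cong F e) (sym d)

Reach-del : ∀ {m} (F : Map m) {b x y} → y ≢ b → Reach F x y → Reach (del F b) x y
Reach-del F {b} {x} y≢b (k , refl) with reached-or-hit k
  where
  reached-or-hit : ∀ k → Reach (del F b) x (iter k F x) ⊎ (iter k F x ≡ b × Reach (del F b) x (F b))
  reached-or-hit zero = inj₁ (0 , refl)
  reached-or-hit (suc k) with reached-or-hit k
  ... | inj₂ (hit , k′ , e) = inj₁ (k′ , trans e (cong F (sym hit)))
  ... | inj₁ (k′ , e) with del-cases F b (iter k F x)
  ...   | inj₁ (hit , d) = inj₂ (hit , suc k′ , trans (cong (del F b) e) d)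
  ...   | inj₂ (_ , d)   = inj₁ (suc k′ , trans (cong (del F b) e) d)
... | inj₁ reached   = reached
... | inj₂ (hit , _) = ⊥-elim (y≢b hit)

iter-del : ∀ {m} (F : Map m) {b x} → (∀ k → iter k F x ≢ b) → ∀ k → iter k (del F b) x ≡ iter k F x
iter-del F avoid zero    = refl
iter-del F avoid (suc k) = trans (cong (del F _) (iter-del F avoid k)) (del-miss F (avoid (suc k)))

Reach-from-successor : ∀ {m} (F : Map m) {b x} → Reach F b x → x ≢ b → Reach F (F b) x
Reach-from-successor F (zero , refl) x≢b = ⊥-elim (x≢b refl)
Reach-from-successor F {b} (suc l , e) _ =
  l , trans (sym (iter-+ F l 1 b)) (trans (cong (λ j → iter j F b) (+-comm l 1)) e)

module Deletion {m} (F : Map m) (D : X m → Set) (D? : ∀ x → Dec (D x))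
                (F-pres : ∀ {x} → D x → D (F x))
                (F-inj : ∀ {x y} → D x → D y → F x ≡ F y → x ≡ y)
                (b : X m) (Db : D b) where

  F⁻ : Map m
  F⁻ = del F b

  D⁻ : X m → Set
  D⁻ x = D x × x ≢ b

  D⁻? : ∀ x → Dec (D⁻ x)
  D⁻? x = D? x ×-dec ¬? (x ≟X b)

  F⁻-pres : ∀ {x} → D⁻ x → D⁻ (F⁻ x)
  F⁻-pres {x} (Dx , x≢b) with del-cases F b x
  ... | inj₁ (hit , d) = subst D (sym d) (F-pres Db) , λ e → x≢b (F-inj Dx Db (trans hit (sym (trans (sym d) e))))
  ... | inj₂ (miss , d) = subst D (sym d) (F-pres Dx) , λ e → miss (trans (sym d) e)

  F⁻-inj : ∀ {x y} → D⁻ x → D⁻ y → F⁻ x ≡ F⁻ y → x ≡ y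
  F⁻-inj {x} {y} (Dx , x≢b) (Dy , y≢b) e with del-cases F b x | del-cases F b y
  ... | inj₁ (hitx , _)  | inj₁ (hity , _)  = F-inj Dx Dy (trans hitx (sym hity))
  ... | inj₁ (_ , dx)    | inj₂ (_ , dy)    = ⊥-elim (y≢b (sym (F-inj Db Dy (trans (sym dx) (trans e dy)))))
  ... | inj₂ (_ , dx)    | inj₁ (_ , dy)    = ⊥-elim (x≢b (F-inj Dx Db (trans (sym dx) (trans e dy))))
  ... | inj₂ (_ , dx)    | inj₂ (_ , dy)    = F-inj Dx Dy (trans (sym dx) (trans e dy))

  module O  = Orbits F  D  D?  F-pres  F-inj
  module O⁻ = Orbits F⁻ D⁻ D⁻? F⁻-pres F⁻-inj

  private
    reaches-b? : ∀ x → Dec (ReachWithin F x b)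
    reaches-b? x = reachWithin? F x b

    avoids : ∀ {x} → D x → ¬ ReachWithin F x b → ∀ k → iter k F x ≢ b
    avoids Dx x↛b k x→b = x↛b (O.reach⇒within Dx (k , x→b))

    off-orbit : ∀ x → 𝟙 (O.cycleMin? x ×-dec ¬? (reaches-b? x))
                    ≡ 𝟙 (O⁻.cycleMin? x ×-dec ¬? (reaches-b? x))
    off-orbit x = 𝟙-cong (O.cycleMin? x ×-dec ¬? (reaches-b? x))
                         (O⁻.cycleMin? x ×-dec ¬? (reaches-b? x))
      (λ ((Dx , x-min) , x↛b) → ((Dx , avoids Dx x↛b 0) ,
         λ k → subst (λ z → rank x ≤ rank z) (sym (iter-del F (avoids Dx x↛b) (toℕ k))) (x-min k)) , x↛b)
      (λ (((Dx , _) , x-min) , x↛b) →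
         (Dx , λ k → subst (λ z → rank x ≤ rank z) (iter-del F (avoids Dx x↛b) (toℕ k)) (x-min k)) , x↛b)

    on-orbit : ΣX (λ x → 𝟙 (O⁻.cycleMin? x ×-dec reaches-b? x)) ≡ 𝟙 (¬? (F b ≟X b))
    on-orbit with F b ≟X b
    ... | yes Fb≡b = ΣX-zero _ λ x → 𝟙-no (O⁻.cycleMin? x ×-dec reaches-b? x)
      λ (((Dx , x≢b) , _) , k , x→b) → case O.Reach-sym Dx (toℕ k , x→b) of λ (l , b→x) →
        x≢b (trans (sym b→x) (iter-fixed F Fb≡b l))
    ... | no Fb≢b = trans (ΣX-cong same-orbit) (O⁻.one-cycleMin-per-orbit (F-pres Db , Fb≢b))
      where
      same-orbit : ∀ x → 𝟙 (O⁻.cycleMin? x ×-dec reaches-b? x)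
                       ≡ 𝟙 (O⁻.cycleMin? x ×-dec reachWithin? F⁻ x (F b))
      same-orbit x = 𝟙-cong (O⁻.cycleMin? x ×-dec reaches-b? x)
                            (O⁻.cycleMin? x ×-dec reachWithin? F⁻ x (F b))
        (λ ((D⁻x@(Dx , x≢b) , x-min) , k , x→b) → (D⁻x , x-min) ,
          O⁻.reach⇒within D⁻x (O⁻.Reach-sym (F-pres Db , Fb≢b)
            (Reach-del F x≢b (Reach-from-successor F (O.Reach-sym Dx (toℕ k , x→b)) x≢b))))
        (λ ((D⁻x@(Dx , _) , x-min) , k , x→Fb) → (D⁻x , x-min) ,
          O.reach⇒within Dx (Reach-trans (Reach-del⁻ F (toℕ k , x→Fb)) (O.Reach-sym Db (1 , refl))))

  -- Cycle minima off the cycle through b survive the deletion of b unchanged; that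
  -- cycle carries one minimum before the deletion and, unless b was fixed, one after.
  cycleMins-del : O.cycleMins ≡ O⁻.cycleMins + 𝟙 (F b ≟X b)
  cycleMins-del = begin
    O.cycleMins
      ≡⟨ ΣX-split O.cycleMin? reaches-b? ⟩
    ΣX (λ x → 𝟙 (O.cycleMin? x ×-dec reaches-b? x)) + ΣX (λ x → 𝟙 (O.cycleMin? x ×-dec ¬? (reaches-b? x)))
      ≡⟨ cong₂ _+_ (O.one-cycleMin-per-orbit Db) (ΣX-cong off-orbit) ⟩
    1 + rest
      ≡⟨ cong (_+ rest) (𝟙-¬? (F b ≟X b)) ⟨
    (𝟙 (¬? (F b ≟X b)) + 𝟙 (F b ≟X b)) + rest
      ≡⟨ xy∙z≈xz∙y (𝟙 (¬? (F b ≟X b))) (𝟙 (F b ≟X b)) rest ⟩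
    (𝟙 (¬? (F b ≟X b)) + rest) + 𝟙 (F b ≟X b)
      ≡⟨ cong (λ t → (t + rest) + 𝟙 (F b ≟X b)) on-orbit ⟨
    (ΣX (λ x → 𝟙 (O⁻.cycleMin? x ×-dec reaches-b? x)) + rest) + 𝟙 (F b ≟X b)
      ≡⟨ cong (_+ 𝟙 (F b ≟X b)) (ΣX-split O⁻.cycleMin? reaches-b?) ⟨
    O⁻.cycleMins + 𝟙 (F b ≟X b) ∎
    where
    open ≡-Reasoning
    rest = ΣX (λ x → 𝟙 (O⁻.cycleMin? x ×-dec ¬? (reaches-b? x)))

del-cong : ∀ {m} {F G : Map m} → F ≗ G → ∀ c → del F c ≗ del G c
del-cong F≗G c y rewrite F≗G y | F≗G c = refl

del-fixed : ∀ {m} (Q : Map m) {c} → Q c ≡ c → del Q c ≗ Q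
del-fixed Q {c} Qc≡c y with del-cases Q c y
... | inj₁ (hit , d) = trans d (trans Qc≡c (sym hit))
... | inj₂ (_ , d)   = d

del-· : ∀ {m} (P Q : Map m) {c} → (∀ {x y} → Q x ≡ Q y → x ≡ y) → Q c ≡ c →
        del (P · Q) c ≗ del P c · Q
del-· P Q {c} Q-inj Qc≡c y with del-cases (P · Q) c y | del-cases P c y
... | inj₁ (_ , d)    | inj₁ (_ , d′)   = trans d (cong Q (sym d′))
... | inj₁ (hit , _)  | inj₂ (miss , _) = ⊥-elim (miss (Q-inj (trans hit (sym Qc≡c))))
... | inj₂ (miss , _) | inj₁ (hit , _)  = ⊥-elim (miss (trans (cong Q hit) Qc≡c))
... | inj₂ (_ , d)    | inj₂ (_ , d′)   = trans d (cong Q (sym d′))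

‖‖-cong : ∀ {m} {F G : Map m} → F ≗ G → ‖ F ‖ ≡ ‖ G ‖
‖‖-cong {F = F} {G} F≗G = trans (‖‖-as-ΣX F) (trans (ΣX-cong same) (sym (‖‖-as-ΣX G)))
  where
  same : ∀ x → 𝟙 (isCycleMin? F x) ≡ 𝟙 (isCycleMin? G x)
  same x = 𝟙-cong (isCycleMin? F x) (isCycleMin? G x)
    (λ F-min k → subst (λ z → rank x ≤ rank z) (iter-cong F≗G (toℕ k) x) (F-min k))
    (λ G-min k → subst (λ z → rank x ≤ rank z) (sym (iter-cong F≗G (toℕ k) x)) (G-min k))

punchIn-lowerFin : ∀ {n} (d : Fin n) (i₀ j : Fin (suc n)) → j ≢ i₀ → punchIn i₀ (lowerFin d i₀ j) ≡ j
punchIn-lowerFin d i₀ j j≢i₀ with i₀ ≟F j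
... | yes i₀≡j = ⊥-elim (j≢i₀ (sym i₀≡j))
... | no i₀≢j  = punchIn-punchOut i₀≢j

module Reduction {n} (i₀ : Fin (suc n)) where

  b θb : X (suc n)
  b  = inS i₀
  θb = θ b

  raise-injective : ∀ {u v} → raise i₀ u ≡ raise i₀ v → u ≡ v
  raise-injective {i , _} {j , _} e with punchIn-injective i₀ i j (cong proj₁ e) | cong proj₂ e
  ... | refl | refl = refl

  raise-lower : ∀ (d : Fin n) z → z ≢ b → z ≢ θb → raise i₀ (lowerFin d i₀ (proj₁ z) , proj₂ z) ≡ z
  raise-lower d (j , s) z≢b z≢θb = cong (_, s) (punchIn-lowerFin d i₀ j (column≢ s z≢b z≢θb))
    where
    column≢ : ∀ s → (j , s) ≢ b → (j , s) ≢ θb → j ≢ i₀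
    column≢ false z≢b _ refl = z≢b refl
    column≢ true _ z≢θb refl = z≢θb refl

  -- D₂ is X (suc n) without b and θb; raise i₀ identifies X n with it and turns
  -- D₂.F⁻ = (F/b)/θb into reduce i₀ F.
  module Reduced (F : Map (suc n)) (F-inj : ∀ {x y} → F x ≡ F y → x ≡ y) where

    module D₁ = Deletion F (λ _ → ⊤) (λ _ → yes tt) (λ _ → tt) (λ _ _ → F-inj) b tt
    module D₂ = Deletion D₁.F⁻ D₁.D⁻ D₁.D⁻? D₁.F⁻-pres D₁.F⁻-inj θb (tt , λ ())

    D₂-raise : ∀ y → D₂.D⁻ (raise i₀ y)
    D₂-raise y = (tt , raise≢pivot i₀ y false) , raise≢pivot i₀ y true

    raise-reduce : ∀ y → raise i₀ (reduce i₀ F y) ≡ D₂.F⁻ (raise i₀ y)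
    raise-reduce y with D₂.F⁻-pres (D₂-raise y)
    ... | (_ , z≢b) , z≢θb = raise-lower (proj₁ y) _ z≢b z≢θb

    reduce-pres-injective : ∀ {x y} → reduce i₀ F x ≡ reduce i₀ F y → x ≡ y
    reduce-pres-injective {x} {y} e = raise-injective (D₂.F⁻-inj (D₂-raise x) (D₂-raise y)
      (trans (sym (raise-reduce x)) (trans (cong (raise i₀) e) (raise-reduce y))))

    raise-iter-reduce : ∀ k y → raise i₀ (iter k (reduce i₀ F) y) ≡ iter k D₂.F⁻ (raise i₀ y)
    raise-iter-reduce zero    y = refl
    raise-iter-reduce (suc k) y = trans (raise-reduce _) (cong D₂.F⁻ (raise-iter-reduce k y))

    module O-reduced = Orbits (reduce i₀ F) (λ _ → ⊤) (λ _ → yes tt) (λ _ → tt) (λ _ _ → reduce-pres-injective)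

    isCycleMin-raise : ∀ y → 𝟙 (D₂.O⁻.cycleMin? (raise i₀ y))
                           ≡ 𝟙 (isCycleMin? (reduce i₀ F) y)
    isCycleMin-raise y = 𝟙-cong (D₂.O⁻.cycleMin? (raise i₀ y)) (isCycleMin? (reduce i₀ F) y)
      (λ (Dy , y-min) k → rank-raise-≤⁻ i₀ y (iter (toℕ k) (reduce i₀ F) y)
         (subst (λ z → rank (raise i₀ y) ≤ rank z) (sym (raise-iter-reduce (toℕ k) y))
           (D₂.O⁻.within⇒cycleMin Dy y-min (toℕ k))))
      (λ y-min → D₂-raise y , λ k →
         subst (λ z → rank (raise i₀ y) ≤ rank z) (raise-iter-reduce (toℕ k) y)
           (rank-raise-≤ i₀ y (iter (toℕ k) (reduce i₀ F) y) (O-reduced.within⇒cycleMin tt y-min (toℕ k))))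

    cycleMins-reduce : D₂.O⁻.cycleMins ≡ ‖ reduce i₀ F ‖
    cycleMins-reduce = begin
      D₂.O⁻.cycleMins                              ≡⟨ ΣX-remove i₀ t ⟩
      (t b + t θb) + ΣX (λ y → t (raise i₀ y))     ≡⟨ cong₂ (λ u v → (u + v) + ΣX (λ y → t (raise i₀ y))) tb≡0 tθb≡0 ⟩
      ΣX (λ y → t (raise i₀ y))                    ≡⟨ ΣX-cong isCycleMin-raise ⟩
      ΣX (λ y → 𝟙 (isCycleMin? (reduce i₀ F) y))   ≡⟨ ‖‖-as-ΣX (reduce i₀ F) ⟨
      ‖ reduce i₀ F ‖                              ∎
      where
      open ≡-Reasoning
      t : X (suc n) → ℕ
      t x = 𝟙 (D₂.O⁻.cycleMin? x)
      tb≡0 : t b ≡ 0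
      tb≡0 = 𝟙-no (D₂.O⁻.cycleMin? b) (λ (((_ , b≢b) , _) , _) → b≢b refl)
      tθb≡0 : t θb ≡ 0
      tθb≡0 = 𝟙-no (D₂.O⁻.cycleMin? θb) (λ ((_ , θb≢θb) , _) → θb≢θb refl)

    cycleCount-reduce : ‖ F ‖ ≡ ‖ reduce i₀ F ‖ + 𝟙 (F b ≟X b) + 𝟙 (del F b θb ≟X θb)
    cycleCount-reduce = begin
      ‖ F ‖                                 ≡⟨ ‖‖-as-ΣX F ⟩
      D₁.O.cycleMins                        ≡⟨ D₁.cycleMins-del ⟩
      D₂.O.cycleMins + 𝟙₁                   ≡⟨ cong (_+ 𝟙₁) D₂.cycleMins-del ⟩
      D₂.O⁻.cycleMins + 𝟙₂ + 𝟙₁             ≡⟨ cong (λ t → t + 𝟙₂ + 𝟙₁) cycleMins-reduce ⟩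
      ‖ reduce i₀ F ‖ + 𝟙₂ + 𝟙₁             ≡⟨ xy∙z≈xz∙y ‖ reduce i₀ F ‖ 𝟙₂ 𝟙₁ ⟩
      ‖ reduce i₀ F ‖ + 𝟙₁ + 𝟙₂             ∎
      where
      open ≡-Reasoning
      𝟙₁ = 𝟙 (F b ≟X b)
      𝟙₂ = 𝟙 (del F b θb ≟X θb)

  del²-fixing : ∀ (Q : Map (suc n)) → Q b ≡ b → Q θb ≡ θb → del (del Q b) θb ≗ Q
  del²-fixing Q Qb Qθb y = trans (del-fixed (del Q b) (trans (del-fixed Q Qb θb) Qθb) y) (del-fixed Q Qb y)

  module Fixing (Q : Map (suc n)) (Q-inj : ∀ {x y} → Q x ≡ Q y → x ≡ y) (Qb : Q b ≡ b) (Qθb : Q θb ≡ θb) where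

    open Reduced Q Q-inj public using (reduce-pres-injective)

    raise-reduce-fixing : ∀ y → raise i₀ (reduce i₀ Q y) ≡ Q (raise i₀ y)
    raise-reduce-fixing y = trans (Reduced.raise-reduce Q Q-inj y) (del²-fixing Q Qb Qθb (raise i₀ y))

    raise-iter-reduce-fixing : ∀ k y → raise i₀ (iter k (reduce i₀ Q) y) ≡ iter k Q (raise i₀ y)
    raise-iter-reduce-fixing k y =
      trans (Reduced.raise-iter-reduce Q Q-inj k y) (iter-cong (del²-fixing Q Qb Qθb) k (raise i₀ y))

    reduce-· : ∀ (P : Map (suc n)) (P-inj : ∀ {x y} → P x ≡ P y → x ≡ y) →
               reduce i₀ (P · Q) ≗ reduce i₀ P · reduce i₀ Q
    reduce-· P P-inj y = raise-injective (begin
      raise i₀ (reduce i₀ (P · Q) y)          ≡⟨ Reduced.raise-reduce (P · Q) (λ e → P-inj (Q-inj e)) y ⟩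
      del (del (P · Q) b) θb (raise i₀ y)      ≡⟨ del-cong (del-· P Q Q-inj Qb) θb (raise i₀ y) ⟩
      del (del P b · Q) θb (raise i₀ y)        ≡⟨ del-· (del P b) Q Q-inj Qθb (raise i₀ y) ⟩
      Q (del (del P b) θb (raise i₀ y))        ≡⟨ cong Q (Reduced.raise-reduce P P-inj y) ⟨
      Q (raise i₀ (reduce i₀ P y))             ≡⟨ raise-reduce-fixing (reduce i₀ P y) ⟨
      raise i₀ (reduce i₀ Q (reduce i₀ P y))   ∎)
      where open ≡-Reasoning

    𝟙-fixed : ∀ {c} → Q c ≡ c → ∀ z → 𝟙 (Q z ≟X c) ≡ 𝟙 (z ≟X c)
    𝟙-fixed {c} Qc≡c z = 𝟙-cong (Q z ≟X c) (z ≟X c) (λ e → Q-inj (trans e (sym Qc≡c))) (λ { refl → Qc≡c })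

    cycleCount-formula : ∀ (P : Map (suc n)) (P-inj : ∀ {x y} → P x ≡ P y → x ≡ y) →
      ‖ P · Q ‖ ≡ ‖ reduce i₀ P · reduce i₀ Q ‖ + δ b (P b) + δ (del P b θb) θb
    cycleCount-formula P P-inj = begin
      ‖ P · Q ‖
        ≡⟨ Reduced.cycleCount-reduce (P · Q) (λ e → P-inj (Q-inj e)) ⟩
      ‖ reduce i₀ (P · Q) ‖ + 𝟙 (Q (P b) ≟X b) + 𝟙 (del (P · Q) b θb ≟X θb)
        ≡⟨ cong₂ (λ u v → ‖ reduce i₀ (P · Q) ‖ + u + v) (𝟙-fixed Qb (P b))
                 (trans (cong (λ z → 𝟙 (z ≟X θb)) (del-· P Q Q-inj Qb θb)) (𝟙-fixed Qθb (del P b θb))) ⟩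
      ‖ reduce i₀ (P · Q) ‖ + 𝟙 (P b ≟X b) + δ (del P b θb) θb
        ≡⟨ cong₂ (λ u v → u + v + δ (del P b θb) θb) (‖‖-cong (reduce-· P P-inj))
                 (𝟙-cong (P b ≟X b) (b ≟X P b) sym sym) ⟩
      ‖ reduce i₀ P · reduce i₀ Q ‖ + δ b (P b) + δ (del P b θb) θb ∎
      where open ≡-Reasoning

  pivot-view : ∀ j → j ≡ i₀ ⊎ ∃ λ j′ → j ≡ punchIn i₀ j′
  pivot-view j with i₀ ≟F j
  ... | yes i₀≡j = inj₁ (sym i₀≡j)
  ... | no i₀≢j  = inj₂ (punchOut i₀≢j , sym (punchIn-punchOut i₀≢j))

  reduce-isEmbedding : ∀ (Π : Partition (suc n)) Q → IsEmbedding Π Q → Q b ≡ b → Q θb ≡ θb →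
                       IsEmbedding (reducePartition i₀ Π) (reduce i₀ Q)
  reduce-isEmbedding Π Q ((Q-inj , Q-surj) , Q-blocks , Q-connected , Q-θ) Qb Qθb =
    (reduce-pres-injective , surjective) , blocks , connected , θ-compatible
    where
    open Fixing Q Q-inj Qb Qθb
    R = reduce i₀ Q

    surjective : ∀ z → ∃ λ x → ∀ {x′} → x′ ≡ x → R x′ ≡ z
    surjective z with Q-surj (raise i₀ z)
    ... | w , Qw≡z = x , λ { refl → raise-injective (trans (raise-reduce-fixing x) (trans (cong Q raise-x) (Qw≡z refl))) }
      where
      x = lowerFin (proj₁ z) i₀ (proj₁ w) , proj₂ w
      raise-x : raise i₀ x ≡ w
      raise-x = raise-lower (proj₁ z) w
        (λ { refl → raise≢pivot i₀ z false (sym (trans (sym Qb) (Qw≡z refl))) })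
        (λ { refl → raise≢pivot i₀ z true (sym (trans (sym Qθb) (Qw≡z refl))) })

    blocks : ∀ i → Σ (Fin n) λ j → R (inS i) ≡ inS j × reducePartition i₀ Π j ≡ reducePartition i₀ Π i
    blocks i with Q-blocks (punchIn i₀ i)
    ... | j′ , Qi≡j′ , same-block = proj₁ (R (inS i)) , cong (proj₁ (R (inS i)) ,_) (cong proj₂ raise-Ri)
                                  , trans (cong (λ z → Π (proj₁ z)) raise-Ri) same-block
      where
      raise-Ri : raise i₀ (R (inS i)) ≡ inS j′
      raise-Ri = trans (raise-reduce-fixing (inS i)) Qi≡j′

    connected : ∀ i j → reducePartition i₀ Π i ≡ reducePartition i₀ Π j → Σ ℕ λ k → iter k R (inS i) ≡ inS j
    connected i j same-block with Q-connected (punchIn i₀ i) (punchIn i₀ j) same-block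
    ... | k , path = k , raise-injective (trans (raise-iter-reduce-fixing k (inS i)) path)

    θ-compatible : ∀ i → R (θ (R (inS i))) ≡ θ (inS i)
    θ-compatible i = raise-injective (begin
      raise i₀ (R (θ (R (inS i))))  ≡⟨ raise-reduce-fixing (θ (R (inS i))) ⟩
      Q (θ (raise i₀ (R (inS i))))  ≡⟨ cong (λ z → Q (θ z)) (raise-reduce-fixing (inS i)) ⟩
      Q (θ (Q (inS (punchIn i₀ i)))) ≡⟨ Q-θ (punchIn i₀ i) ⟩
      θ (inS (punchIn i₀ i))        ∎)
      where open ≡-Reasoning

  reduce-injective : ∀ {Q Q′ : Map (suc n)} →
    (∀ {x y} → Q x ≡ Q y → x ≡ y) → Q b ≡ b → Q θb ≡ θb →
    (∀ {x y} → Q′ x ≡ Q′ y → x ≡ y) → Q′ b ≡ b → Q′ θb ≡ θb →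
    (∀ y → reduce i₀ Q y ≡ reduce i₀ Q′ y) → ∀ x → Q x ≡ Q′ x
  reduce-injective {Q} {Q′} Q-inj Qb Qθb Q′-inj Q′b Q′θb same (j , s) with pivot-view j
  ... | inj₁ refl = on-pivot s
    where
    on-pivot : ∀ s → Q (i₀ , s) ≡ Q′ (i₀ , s)
    on-pivot false = trans Qb (sym Q′b)
    on-pivot true  = trans Qθb (sym Q′θb)
  ... | inj₂ (j′ , refl) = begin
    Q (raise i₀ (j′ , s))               ≡⟨ Fixing.raise-reduce-fixing Q Q-inj Qb Qθb (j′ , s) ⟨
    raise i₀ (reduce i₀ Q (j′ , s))     ≡⟨ cong (raise i₀) (same (j′ , s)) ⟩
    raise i₀ (reduce i₀ Q′ (j′ , s))    ≡⟨ Fixing.raise-reduce-fixing Q′ Q′-inj Q′b Q′θb (j′ , s) ⟩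
    Q′ (raise i₀ (j′ , s))              ∎
    where open ≡-Reasoning

  extend : Map n → Map (suc n)
  extend R (j , s) with i₀ ≟F j
  ... | yes _    = j , s
  ... | no i₀≢j  = raise i₀ (R (punchOut i₀≢j , s))

  extend-pivot : ∀ R s → extend R (i₀ , s) ≡ (i₀ , s)
  extend-pivot R s with i₀ ≟F i₀
  ... | yes _    = refl
  ... | no i₀≢i₀ = ⊥-elim (i₀≢i₀ refl)

  extend-raise : ∀ R y → extend R (raise i₀ y) ≡ raise i₀ (R y)
  extend-raise R (j , s) with i₀ ≟F punchIn i₀ j
  ... | yes i₀≡j = ⊥-elim (punchInᵢ≢i i₀ j (sym i₀≡j))
  ... | no _     = cong (λ l → raise i₀ (R (l , s))) (trans (punchOut-cong′ i₀ refl) (punchOut-punchIn i₀))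

  iter-extend-raise : ∀ R k y → iter k (extend R) (raise i₀ y) ≡ raise i₀ (iter k R y)
  iter-extend-raise R zero    y = refl
  iter-extend-raise R (suc k) y = trans (cong (extend R) (iter-extend-raise R k y)) (extend-raise R _)

  extend-injective : ∀ {R} → (∀ {x y} → R x ≡ R y → x ≡ y) → ∀ {x y} → extend R x ≡ extend R y → x ≡ y
  extend-injective {R} R-inj {j , s} {j′ , s′} e with pivot-view j | pivot-view j′
  ... | inj₁ refl | inj₁ refl = trans (sym (extend-pivot R s)) (trans e (extend-pivot R s′))
  ... | inj₁ refl | inj₂ (k′ , refl) =
    ⊥-elim (raise≢pivot i₀ (R (k′ , s′)) s (sym (trans (sym (extend-pivot R s)) (trans e (extend-raise R (k′ , s′))))))
  ... | inj₂ (k , refl) | inj₁ refl =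
    ⊥-elim (raise≢pivot i₀ (R (k , s)) s′ (trans (sym (extend-raise R (k , s))) (trans e (extend-pivot R s′))))
  ... | inj₂ (k , refl) | inj₂ (k′ , refl) =
    cong (raise i₀) (R-inj (raise-injective
      (trans (sym (extend-raise R (k , s))) (trans e (extend-raise R (k′ , s′))))))

  reduce-surjective : ∀ (Π : Partition (suc n)) → (∀ j → Π j ≡ Π i₀ → j ≡ i₀) →
    ∀ R → IsEmbedding (reducePartition i₀ Π) R →
    Σ (Map (suc n)) λ Q → IsEmbedding Π Q × Q b ≡ b × Q θb ≡ θb × (∀ y → reduce i₀ Q y ≡ R y)
  reduce-surjective Π singleton R ((R-inj , R-surj) , R-blocks , R-connected , R-θ) =
    Q , ((Q-inj , surjective) , blocks , connected , θ-compatible) , extend-pivot R false , extend-pivot R true , reduces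
    where
    Q = extend R
    Q-inj = extend-injective R-inj

    surjective : ∀ z → ∃ λ x → ∀ {x′} → x′ ≡ x → Q x′ ≡ z
    surjective (j , s) with pivot-view j
    ... | inj₁ refl = (i₀ , s) , λ { refl → extend-pivot R s }
    ... | inj₂ (k , refl) with R-surj (k , s)
    ...   | w , Rw≡ = raise i₀ w , λ { refl → trans (extend-raise R w) (cong (raise i₀) (Rw≡ refl)) }

    blocks : ∀ i → Σ (Fin (suc n)) λ j → Q (inS i) ≡ inS j × Π j ≡ Π i
    blocks i with pivot-view i
    ... | inj₁ refl = i₀ , extend-pivot R false , refl
    ... | inj₂ (k , refl) with R-blocks k
    ...   | j , Rk≡j , same-block = punchIn i₀ j , trans (extend-raise R (inS k)) (cong (raise i₀) Rk≡j) , same-block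

    connected : ∀ i j → Π i ≡ Π j → Σ ℕ λ k → iter k Q (inS i) ≡ inS j
    connected i j same-block with pivot-view i | pivot-view j
    ... | inj₁ refl | inj₁ refl = 0 , refl
    ... | inj₁ refl | inj₂ (j′ , refl) = ⊥-elim (punchInᵢ≢i i₀ j′ (singleton _ (sym same-block)))
    ... | inj₂ (i′ , refl) | inj₁ refl = ⊥-elim (punchInᵢ≢i i₀ i′ (singleton _ same-block))
    ... | inj₂ (i′ , refl) | inj₂ (j′ , refl) with R-connected i′ j′ same-block
    ...   | k , path = k , trans (iter-extend-raise R k (inS i′)) (cong (raise i₀) path)

    θ-compatible : ∀ i → Q (θ (Q (inS i))) ≡ θ (inS i)
    θ-compatible i with pivot-view i
    ... | inj₁ refl = trans (cong (λ z → Q (θ z)) (extend-pivot R false)) (extend-pivot R true)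
    ... | inj₂ (k , refl) = trans (cong (λ z → Q (θ z)) (extend-raise R (inS k)))
                              (trans (extend-raise R (θ (R (inS k)))) (cong (raise i₀) (R-θ k)))

    reduces : ∀ y → reduce i₀ Q y ≡ R y
    reduces y = raise-injective (trans (Fixing.raise-reduce-fixing Q Q-inj (extend-pivot R false) (extend-pivot R true) y)
                                       (extend-raise R y))

mainTheorem3 : ∀ (n : ℕ) (P : Map (suc n)) (Π : Partition (suc n)) (i₀ : Fin (suc n)) →
    IsPBPair P Π →
    (∀ j → Π j ≡ Π i₀ → j ≡ i₀) →
    -- f maps S(Π ∪ θΠ, b → b, θb → θb) into S(Π_b ∪ θΠ_b)
    (∀ Q → IsEmbedding Π Q → Q (inS i₀) ≡ inS i₀ → Q (θ (inS i₀)) ≡ θ (inS i₀) →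
      IsEmbedding (reducePartition i₀ Π) (reduce i₀ Q))
    -- f is injective
    × (∀ Q Q′ → IsEmbedding Π Q → Q (inS i₀) ≡ inS i₀ → Q (θ (inS i₀)) ≡ θ (inS i₀) →
       IsEmbedding Π Q′ → Q′ (inS i₀) ≡ inS i₀ → Q′ (θ (inS i₀)) ≡ θ (inS i₀) →
       (∀ y → reduce i₀ Q y ≡ reduce i₀ Q′ y) → ∀ x → Q x ≡ Q′ x)
    -- f is surjective
    × (∀ R → IsEmbedding (reducePartition i₀ Π) R →
       Σ (Map (suc n)) λ Q → IsEmbedding Π Q × Q (inS i₀) ≡ inS i₀ × Q (θ (inS i₀)) ≡ θ (inS i₀)
         × (∀ y → reduce i₀ Q y ≡ R y))
    -- cycle-count formula
    × (∀ Q → IsEmbedding Π Q → Q (inS i₀) ≡ inS i₀ → Q (θ (inS i₀)) ≡ θ (inS i₀) →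
       ‖ P · Q ‖ ≡ ‖ reduce i₀ P · reduce i₀ Q ‖
                   + δ (inS i₀) (P (inS i₀))
                   + δ (del P (inS i₀) (θ (inS i₀))) (θ (inS i₀)))
mainTheorem3 n P Π i₀ ((P-inj , _) , _) singleton =
    reduce-isEmbedding Π
  , (λ { Q Q′ ((Q-inj , _) , _) Qb Qθb ((Q′-inj , _) , _) Q′b Q′θb →
          reduce-injective Q-inj Qb Qθb Q′-inj Q′b Q′θb })
  , reduce-surjective Π singleton
  , (λ { Q ((Q-inj , _) , _) Qb Qθb → Fixing.cycleCount-formula Q Q-inj Qb Qθb P P-inj })
  where open Reduction i₀
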